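{- For every positive integer $h$, the vertex-forwarding index of the multiplicative circulant graph $\Gamma_{3^h}=MC(3^h)$ is $$\xi(\Gamma_{3^h})=3^{h-1}(2h-3)+1.$$
   Context: For integers $m>1$, $h>0$, $MC(m^h)$ is the graph with vertex set $\mathbb{Z}_{m^h}$ in which distinct vertices $x,y$ are adjacent iff $x-y\equiv \pm m^i \pmod{m^h}$ for some $i\in\{0,\ldots,h-1\}$. For a connected graph $\Gamma$ on $N$ vertices, a routing $R$ is a choice of one path $R(x,y)$ from $x$ to $y$ for each of the $N(N-1)$ ordered pairs $(x,y)$ of distinct vertices. The load $\xi_x(\Gamma,R)$ of a vertex $x$ is the number of paths of $R$ having $x$ as an inner (non-end) vertex; $\xi(\Gamma,R)=\max_x \xi_x(\Gamma,R)$; and the vertex-forwarding index is $\xi(\Gamma)=\min_R \xi(\Gamma,R)$ over all routings $R$ of $\Gamma$. -}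

module Defs where

open import Data.Nat using (ℕ; zero; suc; _+_; _*_; _^_; _≤_; _<_; _⊔_; NonZero)
open import Data.Integer using (+_) renaming (_-_ to _ℤ-_; _+_ to _ℤ+_)
open import Data.Integer.Divisibility renaming (_∣_ to _∣ℤ_)
open import Data.Fin using (Fin; toℕ)
open import Data.Fin.Properties using (_≟_)
open import Data.List using (List; []; _∷_; _++_; map; foldr; allFin)
open import Data.Nat.ListAction using (sum)
open import Data.List.Relation.Unary.Linked using (Linked)
open import Data.List.Relation.Unary.Unique.Propositional using (Unique)
open import Data.List.Membership.Propositional using (_∈_)
import Data.List.Membership.DecPropositional as DecMem
open import Data.Product using (Σ; ∃; _×_; proj₁)
open import Data.Sum using (_⊎_)
open import Relation.Binary.PropositionalEquality using (_≡_; _≢_)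
open import Relation.Nullary using (yes; no)

Graph : ℕ → Set₁
Graph N = Fin N → Fin N → Set

-- The multiplicative circulant graph MC(m^h), vertex set Z_{m^h} ≅ Fin (m^h):
-- distinct x, y adjacent iff x - y ≡ ± m^i (mod m^h) for some 0 ≤ i < h.
-- (congruence mod m^h expressed as divisibility in ℤ)
MC : (m h : ℕ) → Graph (m ^ h)
MC m h x y =
  x ≢ y ×
  ∃ λ i → i < h ×
    ((+ (m ^ h) ∣ℤ ((+ toℕ x ℤ- + toℕ y) ℤ- + (m ^ i)))
     ⊎ (+ (m ^ h) ∣ℤ ((+ toℕ x ℤ- + toℕ y) ℤ+ + (m ^ i))))

IsPath : ∀ {N} → Graph N → Fin N → Fin N → List (Fin N) → Set
IsPath G x y inner = Linked G (x ∷ inner ++ y ∷ []) × Unique (x ∷ inner ++ y ∷ [])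

Routing : ∀ {N} → Graph N → Set
Routing {N} G = (x y : Fin N) → x ≢ y → Σ (List (Fin N)) (IsPath G x y)

load : ∀ {N} {G : Graph N} → Routing G → Fin N → ℕ
load {N} R z = sum (map (λ x → sum (map (λ y → count x y) (allFin N))) (allFin N))
  where
  open DecMem (_≟_ {N}) using (_∈?_)
  count : Fin N → Fin N → ℕ
  count x y with x ≟ y
  ... | yes _ = 0
  ... | no x≢y with z ∈? proj₁ (R x y x≢y)
  ...   | yes _ = 1
  ...   | no _ = 0

maxLoad : ∀ {N} {G : Graph N} → Routing G → ℕ
maxLoad {N} R = foldr _⊔_ 0 (map (load R) (allFin N))

IsVertexForwardingIndex : ∀ {N} → Graph N → ℕ → Set
IsVertexForwardingIndex G k =
  (Σ (Routing G) λ R → maxLoad R ≡ k) × ((R : Routing G) → k ≤ maxLoad R)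

-- Write N = 3^h and read residues mod N in balanced ternary (digits 0 and ±1). The weight w(n),
-- the number of nonzero digits of n, changes by at most one along an edge n ~ n ± 3^i of MC(3^h),
-- so a path from x to y has at least w(y − x) − 1 inner vertices; conversely the digits of y − x
-- spell out a path with exactly that many, and translating these paths by x gives a routing that
-- is invariant under the cyclic group. Counting inner vertices over all ordered pairs, every
-- routing has total load at least N (T − (N − 1)), where T = ∑ₙ w(n) = 2h·3^(h−1); so its maximal
-- load is at least T − (N − 1), and the translation-invariant routing, which spreads the total
-- evenly, attains it. Finally T − (N − 1) = 3^(h−1)(2h − 3) + 1.

module Submission where

open import Defs
open import Data.Nat using (ℕ; _^_; _∸_; _≤_)
open import Data.Integer using (+_; _-_) renaming (_*_ to _*ℤ_; _+_ to _+ℤ_)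
open import Data.Product using (Σ; _×_)
open import Relation.Binary.PropositionalEquality using (_≡_)

open import Function using (_∘_; id; _⇔_; mk⇔)
open import Data.Product using (∃; _,_; proj₁; proj₂; uncurry)
open import Data.Empty using (⊥-elim)
open import Data.Bool using (if_then_else_)
open import Data.Nat using (zero; suc; _+_; _*_; _<_; _⊔_; ∣_-_∣; s≤s; z≤n; NonZero; >-nonZero; pred)
open import Data.Nat.Properties hiding (_≟_)
open import Data.List using (List; []; _∷_; _++_; length; map; foldr; allFin; upTo; applyUpTo; tabulate)
open import Data.List.Properties
  using (map-cong; map-∘; map-++; map-tabulate; map-applyUpTo; map-upTo; upTo-∷ʳ; length-upTo; length-++; length-map; length-tabulate)
open import Data.Nat.DivMod
open import Data.Nat.Divisibility using (_∣_; divides; ∣-refl)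
open import Data.Integer.Divisibility using () renaming (_∣_ to _∣ℤ_)
import Data.Integer.Properties as ℤ
open import Data.Sum using (_⊎_; inj₁; inj₂)
open import Data.Nat.ListAction using (sum)
open import Data.Nat.ListAction.Properties using (sum-++)
open import Data.List.Relation.Unary.Any using (here; there)
open import Data.List.Relation.Unary.All using ([]; _∷_)
import Data.List.Relation.Unary.All as All
import Data.List.Relation.Unary.AllPairs as AllPairs
import Data.List.Relation.Unary.AllPairs.Properties as AllPairs
open import Data.List.Relation.Unary.AllPairs using (AllPairs; []; _∷_)
import Data.List.Relation.Unary.All.Properties as All
open import Data.List.Relation.Unary.Unique.Propositional using (Unique)
open import Data.List.Relation.Unary.Linked using (Linked; [-]; _∷_)
import Data.List.Relation.Unary.Linked as Linked
import Data.List.Relation.Unary.Linked.Properties as Linked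
open import Data.List.Relation.Unary.Unique.Propositional.Properties using (allFin⁺)
open import Data.List.Membership.Propositional using (_∈_)
open import Data.List.Membership.Propositional.Properties using (∈-allFin; ∈-upTo⁻)
import Data.List.Membership.DecPropositional as DecMembership
open import Data.Fin using (Fin; toℕ; fromℕ<)
open import Data.Fin.Properties using (_≟_; toℕ<n; toℕ-injective; toℕ-fromℕ<; fromℕ<-cong)
open import Relation.Nullary using (Dec; yes; no; ¬_; does)
open import Relation.Nullary.Decidable using (dec-true; dec-false; does-⇔)
open import Algebra.Properties.CommutativeSemigroup +-commutativeSemigroup using (interchange)
open import Data.Nat.Tactic.RingSolver using (solve-∀)
import Data.Integer.Tactic.RingSolver as ℤSolver
open import Relation.Binary.PropositionalEquality using (refl; sym; trans; cong; cong₂; subst; subst₂; _≢_; module ≡-Reasoning)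

∑ : ∀ {A : Set} → List A → (A → ℕ) → ℕ
∑ L f = sum (map f L)

syntax ∑ L (λ x → e) = ∑[ x ∈ L ] e

∑< : ℕ → (ℕ → ℕ) → ℕ
∑< n = ∑ (upTo n)

syntax ∑< n (λ k → e) = ∑[ k < n ] e

module _ {A : Set} where

  ∑-cong : ∀ (L : List A) {f g : A → ℕ} → (∀ {a} → a ∈ L → f a ≡ g a) → ∑ L f ≡ ∑ L g
  ∑-cong []      f≗g = refl
  ∑-cong (a ∷ L) f≗g = cong₂ _+_ (f≗g (here refl)) (∑-cong L (f≗g ∘ there))

  ∑-distrib-+ : ∀ (L : List A) (f g : A → ℕ) → ∑[ a ∈ L ] (f a + g a) ≡ ∑ L f + ∑ L g
  ∑-distrib-+ []      f g = refl
  ∑-distrib-+ (a ∷ L) f g rewrite ∑-distrib-+ L f g = interchange (f a) (g a) (∑ L f) (∑ L g)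

  ∑-const : ∀ (L : List A) c → ∑[ _ ∈ L ] c ≡ length L * c
  ∑-const []      c = refl
  ∑-const (a ∷ L) c = cong (_+_ c) (∑-const L c)

  ∑-zero : ∀ (L : List A) → ∑[ _ ∈ L ] 0 ≡ 0
  ∑-zero L = trans (∑-const L 0) (*-zeroʳ (length L))

  ∑-mono-≤ : ∀ (L : List A) {f g : A → ℕ} → (∀ a → f a ≤ g a) → ∑ L f ≤ ∑ L g
  ∑-mono-≤ []      f≤g = z≤n
  ∑-mono-≤ (a ∷ L) f≤g = +-mono-≤ (f≤g a) (∑-mono-≤ L f≤g)

  ∑≤length*max : ∀ (L : List A) (f : A → ℕ) → ∑ L f ≤ length L * foldr _⊔_ 0 (map f L)
  ∑≤length*max []      f = z≤n
  ∑≤length*max (a ∷ L) f =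
    +-mono-≤ (m≤m⊔n (f a) _) (≤-trans (∑≤length*max L f) (*-monoʳ-≤ (length L) (m≤n⊔m (f a) _)))

∑-comm : ∀ {A B : Set} (L : List A) (M : List B) (f : A → B → ℕ) →
         ∑[ a ∈ L ] ∑[ b ∈ M ] f a b ≡ ∑[ b ∈ M ] ∑[ a ∈ L ] f a b
∑-comm []      M f = sym (∑-zero M)
∑-comm (a ∷ L) M f = begin
  ∑[ b ∈ M ] f a b + ∑[ a′ ∈ L ] ∑[ b ∈ M ] f a′ b  ≡⟨ cong (_+_ (∑[ b ∈ M ] f a b)) (∑-comm L M f) ⟩
  ∑[ b ∈ M ] f a b + ∑[ b ∈ M ] ∑[ a′ ∈ L ] f a′ b  ≡⟨ ∑-distrib-+ M (f a) _ ⟨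
  ∑[ b ∈ M ] (f a b + ∑[ a′ ∈ L ] f a′ b)           ∎
  where open ≡-Reasoning

∑<-suc : ∀ n (f : ℕ → ℕ) → ∑[ k < suc n ] f k ≡ f 0 + ∑[ k < n ] f (suc k)
∑<-suc n f = cong (_+_ (f 0) ∘ sum) (trans (map-applyUpTo suc f n) (sym (map-upTo (f ∘ suc) n)))

∑<-snoc : ∀ n (f : ℕ → ℕ) → ∑[ k < suc n ] f k ≡ ∑[ k < n ] f k + f n
∑<-snoc n f = begin
  sum (map f (upTo (suc n)))            ≡⟨ cong (sum ∘ map f) (upTo-∷ʳ n) ⟨
  sum (map f (upTo n ++ n ∷ []))        ≡⟨ cong sum (map-++ f (upTo n) (n ∷ [])) ⟩
  sum (map f (upTo n) ++ f n ∷ [])      ≡⟨ sum-++ (map f (upTo n)) (f n ∷ []) ⟩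
  ∑[ k < n ] f k + (f n + 0)            ≡⟨ cong (_+_ (∑[ k < n ] f k)) (+-identityʳ (f n)) ⟩
  ∑[ k < n ] f k + f n                  ∎
  where open ≡-Reasoning

∑<-const : ∀ n c → ∑[ _ < n ] c ≡ n * c
∑<-const n c = trans (∑-const (upTo n) c) (cong (_* c) (length-upTo n))

∑<-cong : ∀ n {f g : ℕ → ℕ} → (∀ {k} → k < n → f k ≡ g k) → ∑[ k < n ] f k ≡ ∑[ k < n ] g k
∑<-cong n f≗g = ∑-cong (upTo n) (f≗g ∘ ∈-upTo⁻)

∑<-rotate : ∀ n (g : ℕ → ℕ) → g n ≡ g 0 → ∑[ k < n ] g (suc k) ≡ ∑[ k < n ] g k
∑<-rotate n g gn≡g0 = +-cancelˡ-≡ (g 0) _ _ (begin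
  g 0 + ∑[ k < n ] g (suc k)  ≡⟨ ∑<-suc n g ⟨
  ∑[ k < suc n ] g k          ≡⟨ ∑<-snoc n g ⟩
  ∑[ k < n ] g k + g n        ≡⟨ cong (_+_ (∑[ k < n ] g k)) gn≡g0 ⟩
  ∑[ k < n ] g k + g 0        ≡⟨ +-comm _ (g 0) ⟩
  g 0 + ∑[ k < n ] g k        ∎)
  where open ≡-Reasoning

∑<-shift-periodic : ∀ n (f : ℕ → ℕ) → (∀ m → f (m + n) ≡ f m) →
                    ∀ c → ∑[ k < n ] f (k + c) ≡ ∑[ k < n ] f k
∑<-shift-periodic n f periodic zero    = ∑-cong (upTo n) (λ {k} _ → cong f (+-identityʳ k))
∑<-shift-periodic n f periodic (suc c) = begin
  ∑[ k < n ] f (k + suc c)  ≡⟨ ∑-cong (upTo n) (λ {k} _ → cong f (+-suc k c)) ⟩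
  ∑[ k < n ] f (suc k + c)  ≡⟨ ∑<-rotate n (λ k → f (k + c)) (trans (cong f (+-comm n c)) (periodic c)) ⟩
  ∑[ k < n ] f (k + c)      ≡⟨ ∑<-shift-periodic n f periodic c ⟩
  ∑[ k < n ] f k            ∎
  where open ≡-Reasoning

∑<-*3 : ∀ n (f : ℕ → ℕ) →
        ∑[ k < n * 3 ] f k ≡ ∑[ q < n ] (f (q * 3) + f (1 + q * 3) + f (2 + q * 3))
∑<-*3 zero    f = refl
∑<-*3 (suc n) f = begin
  ∑[ k < 3 + n * 3 ] f k
    ≡⟨ trans (∑<-suc (2 + n * 3) f) (cong (_+_ (f 0)) (trans (∑<-suc (1 + n * 3) (f ∘ suc))
         (cong (_+_ (f 1)) (∑<-suc (n * 3) (f ∘ _+_ 2))))) ⟩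
  f 0 + (f 1 + (f 2 + ∑[ k < n * 3 ] f (3 + k)))
    ≡⟨ cong (λ t → f 0 + (f 1 + (f 2 + t))) (∑<-*3 n (f ∘ _+_ 3)) ⟩
  f 0 + (f 1 + (f 2 + ∑[ q < n ] (f (3 + q * 3) + f (4 + q * 3) + f (5 + q * 3))))
    ≡⟨ reassociate (f 0) (f 1) (f 2) _ ⟩
  f 0 + f 1 + f 2 + ∑[ q < n ] (f (3 + q * 3) + f (4 + q * 3) + f (5 + q * 3))
    ≡⟨ ∑<-suc n (λ q → f (q * 3) + f (1 + q * 3) + f (2 + q * 3)) ⟨
  ∑[ q < suc n ] (f (q * 3) + f (1 + q * 3) + f (2 + q * 3)) ∎
  where
  open ≡-Reasoning
  reassociate : ∀ a b c x → a + (b + (c + x)) ≡ a + b + c + x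
  reassociate = solve-∀

tabulate-toℕ : ∀ n (f : ℕ → ℕ) → tabulate {n = n} (f ∘ toℕ) ≡ applyUpTo f n
tabulate-toℕ zero    f = refl
tabulate-toℕ (suc n) f = cong (f 0 ∷_) (tabulate-toℕ n (f ∘ suc))

∑-allFin-const : ∀ n c → ∑[ _ ∈ allFin n ] c ≡ n * c
∑-allFin-const n c = trans (∑-const (allFin n) c) (cong (_* c) (length-tabulate {n = n} id))

∑-allFin : ∀ n (f : ℕ → ℕ) → ∑[ x ∈ allFin n ] f (toℕ x) ≡ ∑[ k < n ] f k
∑-allFin n f = cong sum (begin
  map (f ∘ toℕ) (allFin n)  ≡⟨ map-tabulate id (f ∘ toℕ) ⟩
  tabulate (f ∘ toℕ)        ≡⟨ tabulate-toℕ n f ⟩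
  applyUpTo f n             ≡⟨ map-upTo f n ⟨
  map f (upTo n)            ∎)
  where open ≡-Reasoning

𝟙 : ∀ {P : Set} → Dec P → ℕ
𝟙 d = if does d then 1 else 0

module _ {P : Set} where

  𝟙-yes : (d : Dec P) → P → 𝟙 d ≡ 1
  𝟙-yes d p = cong (λ b → if b then 1 else 0) (dec-true d p)

  𝟙-no : (d : Dec P) → ¬ P → 𝟙 d ≡ 0
  𝟙-no d ¬p = cong (λ b → if b then 1 else 0) (dec-false d ¬p)

  𝟙-⇔ : ∀ {Q : Set} → P ⇔ Q → (d : Dec P) (e : Dec Q) → 𝟙 d ≡ 𝟙 e
  𝟙-⇔ P⇔Q d e = cong (λ b → if b then 1 else 0) (does-⇔ P⇔Q d e)

module _ {n : ℕ} where
  open DecMembership (_≟_ {n}) using (_∈?_)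

  𝟙-∈-unique : ∀ z {L : List (Fin n)} → Unique L → 𝟙 (z ∈? L) ≡ ∑[ b ∈ L ] 𝟙 (z ≟ b)
  𝟙-∈-unique z {[]}    []          = refl
  𝟙-∈-unique z {a ∷ L} (a∉L ∷ uniq) with z ≟ a
  ... | yes refl = cong suc (sym (trans (∑-cong L (λ b∈L → 𝟙-no (z ≟ _) (λ { refl → All.lookup a∉L b∈L refl })))
                                       (∑-zero L)))
  ... | no  z≢a  = 𝟙-∈-unique z uniq

  ∑-𝟙-≟ʳ : ∀ a → ∑[ z ∈ allFin n ] 𝟙 (a ≟ z) ≡ 1
  ∑-𝟙-≟ʳ a = trans (sym (𝟙-∈-unique a (allFin⁺ n))) (𝟙-yes (a ∈? allFin n) (∈-allFin a))

  ∑-𝟙-≟ˡ : ∀ a → ∑[ z ∈ allFin n ] 𝟙 (z ≟ a) ≡ 1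
  ∑-𝟙-≟ˡ a = trans (∑-cong (allFin n) (λ {z} _ → 𝟙-⇔ (mk⇔ sym sym) (z ≟ a) (a ≟ z))) (∑-𝟙-≟ʳ a)

  ∑-𝟙-∈-unique : ∀ {L : List (Fin n)} → Unique L → ∑[ z ∈ allFin n ] 𝟙 (z ∈? L) ≡ length L
  ∑-𝟙-∈-unique {L} uniq = begin
    ∑[ z ∈ allFin n ] 𝟙 (z ∈? L)                ≡⟨ ∑-cong (allFin n) (λ {z} _ → 𝟙-∈-unique z uniq) ⟩
    ∑[ z ∈ allFin n ] ∑[ b ∈ L ] 𝟙 (z ≟ b)      ≡⟨ ∑-comm (allFin n) L (λ z b → 𝟙 (z ≟ b)) ⟩
    ∑[ b ∈ L ] ∑[ z ∈ allFin n ] 𝟙 (z ≟ b)      ≡⟨ ∑-cong L (λ {b} _ → ∑-𝟙-≟ˡ b) ⟩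
    ∑[ b ∈ L ] 1                                ≡⟨ ∑-const L 1 ⟩
    length L * 1                                ≡⟨ *-identityʳ (length L) ⟩
    length L                                    ∎
    where open ≡-Reasoning

AllPairs-++⁻ˡ : ∀ {A : Set} {_R_ : A → A → Set} xs {ys} → AllPairs _R_ (xs ++ ys) → AllPairs _R_ xs
AllPairs-++⁻ˡ []       _         = []
AllPairs-++⁻ˡ (x ∷ xs) (r ∷ rs) = All.++⁻ˡ xs r ∷ AllPairs-++⁻ˡ xs rs

module _ {A : Set} where

  last : A → List A → A
  last a []      = a
  last a (b ∷ l) = last b l

  init : List A → List A
  init []          = []
  init (a ∷ [])    = []
  init (a ∷ b ∷ l) = a ∷ init (b ∷ l)

  ∷≡init++last : ∀ a l → a ∷ l ≡ init (a ∷ l) ++ last a l ∷ []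
  ∷≡init++last a []      = refl
  ∷≡init++last a (b ∷ l) = cong (a ∷_) (∷≡init++last b l)

  length-init : ∀ l → length (init l) ≡ pred (length l)
  length-init []          = refl
  length-init (a ∷ [])    = refl
  length-init (a ∷ b ∷ l) = cong suc (length-init (b ∷ l))

  last-∷ʳ : ∀ a l s → last a (l ++ s ∷ []) ≡ s
  last-∷ʳ a []      s = refl
  last-∷ʳ a (b ∷ l) s = last-∷ʳ b l s

  length-∷ʳ : ∀ l (s : A) → length (l ++ s ∷ []) ≡ suc (length l)
  length-∷ʳ l s = trans (length-++ l) (+-comm (length l) 1)

  AllPairs-init : ∀ {_R_ : A → A → Set} l → AllPairs _R_ l → AllPairs _R_ (init l)
  AllPairs-init []      _     = []
  AllPairs-init (a ∷ l) pairs = AllPairs-++⁻ˡ (init (a ∷ l)) (subst (AllPairs _) (∷≡init++last a l) pairs)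

  Linked-∷ʳ : ∀ {_R_ : A → A → Set} {a} l {s} → Linked _R_ (a ∷ l) → last a l R s → Linked _R_ (a ∷ l ++ s ∷ [])
  Linked-∷ʳ []      _          r = r ∷ [-]
  Linked-∷ʳ (b ∷ l) (r ∷ rs)  r′ = r ∷ Linked-∷ʳ l rs r′

last-map : ∀ {A B : Set} (f : A → B) a l → last (f a) (map f l) ≡ f (last a l)
last-map f a []      = refl
last-map f a (b ∷ l) = last-map f b l

module _ {n : ℕ} {G : Graph n} (R : Routing G) where
  open DecMembership (_≟_ {n}) using (_∈?_)

  passes : Fin n → Fin n → Fin n → ℕ
  passes z x y with x ≟ y
  ... | yes _   = 0
  ... | no  x≢y = 𝟙 (z ∈? proj₁ (R x y x≢y))

  pathLength : Fin n → Fin n → ℕ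
  pathLength x y with x ≟ y
  ... | yes _   = 0
  ... | no  x≢y = length (proj₁ (R x y x≢y))

  -- The left-hand side is the summand of `load`, local to its definition, so it is inferred from the use below.
  count≡passes : ∀ z x y → _ ≡ passes z x y

  load≡∑passes : ∀ z → load R z ≡ ∑[ x ∈ allFin n ] ∑[ y ∈ allFin n ] passes z x y
  load≡∑passes z = cong sum (map-cong (λ x → cong sum (map-cong (count≡passes z x) (allFin n))) (allFin n))

  count≡passes z x y with x ≟ y
  ... | yes _ = refl
  ... | no x≢y with z ∈? proj₁ (R x y x≢y)
  ...   | yes _ = refl
  ...   | no  _ = refl

  ∑-passes≡pathLength : ∀ x y → ∑[ z ∈ allFin n ] passes z x y ≡ pathLength x y
  ∑-passes≡pathLength x y with x ≟ y
  ... | yes _   = ∑-zero (allFin n)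
  ... | no  x≢y = ∑-𝟙-∈-unique (inner-unique (proj₂ (proj₂ (R x y x≢y))))
    where
    inner-unique : ∀ {L} → Unique (x ∷ L ++ y ∷ []) → Unique L
    inner-unique (_ ∷ uniq) = AllPairs-++⁻ˡ _ uniq

  ∑-load≡∑-pathLength : ∑[ z ∈ allFin n ] load R z ≡ ∑[ x ∈ allFin n ] ∑[ y ∈ allFin n ] pathLength x y
  ∑-load≡∑-pathLength = begin
    ∑[ z ∈ allFin n ] load R z
      ≡⟨ ∑-cong (allFin n) (λ {z} _ → load≡∑passes z) ⟩
    ∑[ z ∈ allFin n ] ∑[ x ∈ allFin n ] ∑[ y ∈ allFin n ] passes z x y
      ≡⟨ ∑-comm (allFin n) (allFin n) _ ⟩
    ∑[ x ∈ allFin n ] ∑[ z ∈ allFin n ] ∑[ y ∈ allFin n ] passes z x y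
      ≡⟨ ∑-cong (allFin n) (λ {x} _ → ∑-comm (allFin n) (allFin n) (λ z y → passes z x y)) ⟩
    ∑[ x ∈ allFin n ] ∑[ y ∈ allFin n ] ∑[ z ∈ allFin n ] passes z x y
      ≡⟨ ∑-cong (allFin n) (λ {x} _ → ∑-cong (allFin n) (λ {y} _ → ∑-passes≡pathLength x y)) ⟩
    ∑[ x ∈ allFin n ] ∑[ y ∈ allFin n ] pathLength x y ∎
    where open ≡-Reasoning

  maxLoad≤ : ∀ {k} → (∀ z → load R z ≤ k) → maxLoad R ≤ k
  maxLoad≤ {k} load≤k = lub (allFin n)
    where
    lub : ∀ zs → foldr _⊔_ 0 (map (load R) zs) ≤ k
    lub []       = z≤n
    lub (z ∷ zs) = ⊔-lub (load≤k z) (lub zs)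

  ∑-load≤n*maxLoad : ∑[ z ∈ allFin n ] load R z ≤ n * maxLoad R
  ∑-load≤n*maxLoad =
    subst (λ l → ∑[ z ∈ allFin n ] load R z ≤ l * maxLoad R) (length-tabulate {n = n} id) (∑≤length*max (allFin n) (load R))

∣m-n∣≤1⇒m≤1+n : ∀ {m n} → ∣ m - n ∣ ≤ 1 → m ≤ suc n
∣m-n∣≤1⇒m≤1+n {m} {n} ∣m-n∣≤1 =
  ≤-trans (m≤n+∣m-n∣ m n) (≤-trans (+-monoʳ-≤ n ∣m-n∣≤1) (≤-reflexive (+-comm n 1)))

m+[[n∸m]+o]≡n+o : ∀ {m n} o → m ≤ n → m + ((n ∸ m) + o) ≡ n + o
m+[[n∸m]+o]≡n+o {m} {n} o m≤n = trans (sym (+-assoc m (n ∸ m) o)) (cong (_+ o) (m+[n∸m]≡n m≤n))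

m+o+[n∸m]≡n+o : ∀ {m n} o → m ≤ n → m + o + (n ∸ m) ≡ n + o
m+o+[n∸m]≡n+o {m} {n} o m≤n =
  trans (+-assoc m o (n ∸ m)) (trans (cong (_+_ m) (+-comm o (n ∸ m))) (m+[[n∸m]+o]≡n+o o m≤n))

[+a-+b]-+c≡+a-+[b+c] : ∀ a b c → (+ a - + b) - + c ≡ + a - + (b + c)
[+a-+b]-+c≡+a-+[b+c] a b c = trans (regroup (+ a) (+ b) (+ c)) (cong (λ t → + a - t) (sym (ℤ.pos-+ b c)))
  where
  regroup : ∀ x y z → (x - y) - z ≡ x - (y +ℤ z)
  regroup = ℤSolver.solve-∀

[+a-+b]++c≡+[a+c]-+b : ∀ a b c → (+ a - + b) +ℤ + c ≡ + (a + c) - + b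
[+a-+b]++c≡+[a+c]-+b a b c = trans (regroup (+ a) (+ b) (+ c)) (cong (_- + b) (sym (ℤ.pos-+ a c)))
  where
  regroup : ∀ x y z → (x - y) +ℤ z ≡ (x +ℤ z) - y
  regroup = ℤSolver.solve-∀

infix 4 _≡_[mod_]
_≡_[mod_] : ℕ → ℕ → (N : ℕ) → .{{NonZero N}} → Set
a ≡ b [mod N ] = a % N ≡ b % N

module _ {N : ℕ} .{{_ : NonZero N}} where

  ≡[mod]-+ˡ : ∀ c {a b} → a ≡ b [mod N ] → c + a ≡ c + b [mod N ]
  ≡[mod]-+ˡ c {a} {b} a≡b = begin
    (c + a) % N              ≡⟨ %-distribˡ-+ c a N ⟩
    (c % N + a % N) % N      ≡⟨ cong (λ t → (c % N + t) % N) a≡b ⟩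
    (c % N + b % N) % N      ≡⟨ %-distribˡ-+ c b N ⟨
    (c + b) % N              ∎
    where open ≡-Reasoning

  ≡[mod]-+ʳ : ∀ c {a b} → a ≡ b [mod N ] → a + c ≡ b + c [mod N ]
  ≡[mod]-+ʳ c {a} {b} a≡b rewrite +-comm a c | +-comm b c = ≡[mod]-+ˡ c a≡b

  ≡[mod]-cancel-+ˡ : ∀ c {a b} → c ≤ N → c + a ≡ c + b [mod N ] → a ≡ b [mod N ]
  ≡[mod]-cancel-+ˡ c {a} {b} c≤N c+a≡c+b = begin
    a % N                  ≡⟨ %-remove-+ˡ a (∣-refl {N}) ⟨
    (N + a) % N            ≡⟨ cong (_% N) (m+o+[n∸m]≡n+o a c≤N) ⟨
    (c + a + (N ∸ c)) % N  ≡⟨ ≡[mod]-+ʳ (N ∸ c) c+a≡c+b ⟩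
    (c + b + (N ∸ c)) % N  ≡⟨ cong (_% N) (m+o+[n∸m]≡n+o b c≤N) ⟩
    (N + b) % N            ≡⟨ %-remove-+ˡ b (∣-refl {N}) ⟩
    b % N                  ∎
    where open ≡-Reasoning

  ≡[mod]⇒∣∸ : ∀ {u v} → v ≤ u → u ≡ v [mod N ] → N ∣ u ∸ v
  ≡[mod]⇒∣∸ {u} {v} _ u≡v = divides (u / N ∸ v / N) (begin
    u ∸ v                                       ≡⟨ cong₂ _∸_ (m≡m%n+[m/n]*n u N) (m≡m%n+[m/n]*n v N) ⟩
    (u % N + u / N * N) ∸ (v % N + v / N * N)   ≡⟨ cong (λ t → (t + u / N * N) ∸ (v % N + v / N * N)) u≡v ⟩
    (v % N + u / N * N) ∸ (v % N + v / N * N)   ≡⟨ [m+n]∸[m+o]≡n∸o (v % N) _ _ ⟩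
    u / N * N ∸ v / N * N                       ≡⟨ *-distribʳ-∸ N (u / N) (v / N) ⟨
    (u / N ∸ v / N) * N                         ∎)
    where open ≡-Reasoning

  ∣∸⇒≡[mod] : ∀ {u v} → v ≤ u → N ∣ u ∸ v → u ≡ v [mod N ]
  ∣∸⇒≡[mod] {u} {v} v≤u N∣u∸v = trans (cong (_% N) (sym (m+[n∸m]≡n v≤u))) (%-remove-+ʳ v N∣u∸v)

  ≡[mod]⇒∣ℤ : ∀ u v → u ≡ v [mod N ] → + N ∣ℤ (+ u - + v)
  ≡[mod]⇒∣ℤ u v u≡v rewrite ℤ.[+m]-[+n]≡m⊖n u v with ≤-total u v
  ... | inj₁ u≤v rewrite ℤ.∣⊖∣-≤ u≤v = ≡[mod]⇒∣∸ u≤v (sym u≡v)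
  ... | inj₂ v≤u rewrite ℤ.∣m⊖n∣≡∣n⊖m∣ u v | ℤ.∣⊖∣-≤ v≤u = ≡[mod]⇒∣∸ v≤u u≡v

  ∣ℤ⇒≡[mod] : ∀ u v → + N ∣ℤ (+ u - + v) → u ≡ v [mod N ]
  ∣ℤ⇒≡[mod] u v N∣u-v rewrite ℤ.[+m]-[+n]≡m⊖n u v with ≤-total u v
  ... | inj₁ u≤v rewrite ℤ.∣⊖∣-≤ u≤v = sym (∣∸⇒≡[mod] u≤v N∣u-v)
  ... | inj₂ v≤u rewrite ℤ.∣m⊖n∣≡∣n⊖m∣ u v | ℤ.∣⊖∣-≤ v≤u = ∣∸⇒≡[mod] v≤u N∣u-v

infix 4 _≡_[mod3^_]
_≡_[mod3^_] : ℕ → ℕ → ℕ → Set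
a ≡ b [mod3^ h ] = _≡_[mod_] a b (3 ^ h) {{m^n≢0 3 h}}

≡⇒≡[mod3^] : ∀ h {a b} → a ≡ b → a ≡ b [mod3^ h ]
≡⇒≡[mod3^] h refl = refl

data Ternary : ℕ → Set where
  rem0 : ∀ q → Ternary (q * 3)
  rem1 : ∀ q → Ternary (1 + q * 3)
  rem2 : ∀ q → Ternary (2 + q * 3)

ternary : ∀ n → Ternary n
ternary zero = rem0 0
ternary (suc n) with ternary n
... | rem0 q = rem1 q
... | rem1 q = rem2 q
... | rem2 q = rem0 (suc q)

ternary-rem0 : ∀ q → ternary (q * 3) ≡ rem0 q
ternary-rem0 zero    = refl
ternary-rem0 (suc q) rewrite ternary-rem0 q = refl

ternary-rem1 : ∀ q → ternary (1 + q * 3) ≡ rem1 q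
ternary-rem1 q rewrite ternary-rem0 q = refl

ternary-rem2 : ∀ q → ternary (2 + q * 3) ≡ rem2 q
ternary-rem2 q rewrite ternary-rem1 q = refl

-- The number of nonzero digits of n mod 3^h in balanced ternary (digit 2 is read as -1 with a carry).
weight : ℕ → ℕ → ℕ
weight zero    n = 0
weight (suc h) n with ternary n
... | rem0 q = weight h q
... | rem1 q = suc (weight h q)
... | rem2 q = suc (weight h (suc q))

weight-rem0 : ∀ h q → weight (suc h) (q * 3) ≡ weight h q
weight-rem0 h q rewrite ternary-rem0 q = refl

weight-rem1 : ∀ h q → weight (suc h) (1 + q * 3) ≡ suc (weight h q)
weight-rem1 h q rewrite ternary-rem1 q = refl

weight-rem2 : ∀ h q → weight (suc h) (2 + q * 3) ≡ suc (weight h (suc q))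
weight-rem2 h q rewrite ternary-rem2 q = refl

weight-0 : ∀ h → weight h 0 ≡ 0
weight-0 zero    = refl
weight-0 (suc h) = weight-0 h

weight-+*3 : (_R_ : ℕ → ℕ → Set) → (∀ {a b} → a R b → suc a R suc b) →
             ∀ h m → (∀ q → weight h (q + m) R weight h q) →
             ∀ n → weight (suc h) (n + m * 3) R weight (suc h) n
weight-+*3 _R_ suc-R h m R-shift n = go (ternary n)
  where
  go : ∀ {n} → Ternary n → weight (suc h) (n + m * 3) R weight (suc h) n
  go (rem0 q) rewrite sym (*-distribʳ-+ 3 q m) | weight-rem0 h (q + m) | weight-rem0 h q = R-shift q
  go (rem1 q) rewrite sym (*-distribʳ-+ 3 q m) | weight-rem1 h (q + m) | weight-rem1 h q = suc-R (R-shift q)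
  go (rem2 q) rewrite sym (*-distribʳ-+ 3 q m) | weight-rem2 h (q + m) | weight-rem2 h q = suc-R (R-shift (suc q))

weight-periodic : ∀ h n → weight h (n + 3 ^ h) ≡ weight h n
weight-periodic zero    n = refl
weight-periodic (suc h) n rewrite *-comm 3 (3 ^ h) =
  weight-+*3 _≡_ (cong suc) h (3 ^ h) (weight-periodic h) n

∣n-1+n∣≡1 : ∀ n → ∣ n - suc n ∣ ≡ 1
∣n-1+n∣≡1 zero    = refl
∣n-1+n∣≡1 (suc n) = ∣n-1+n∣≡1 n

weight-suc : ∀ h n → ∣ weight h (suc n) - weight h n ∣ ≤ 1
weight-suc zero    n = z≤n
weight-suc (suc h) n = go (ternary n)
  where
  go : ∀ {n} → Ternary n → ∣ weight (suc h) (suc n) - weight (suc h) n ∣ ≤ 1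
  go (rem0 q) rewrite weight-rem1 h q | weight-rem0 h q
    = ≤-reflexive (trans (∣-∣-comm (suc (weight h q)) (weight h q)) (∣n-1+n∣≡1 (weight h q)))
  go (rem1 q) rewrite weight-rem2 h q | weight-rem1 h q = weight-suc h q
  go (rem2 q) rewrite weight-rem0 h (suc q) | weight-rem2 h q = ≤-reflexive (∣n-1+n∣≡1 (weight h (suc q)))

weight-+3^ : ∀ h i n → i < h → ∣ weight h (n + 3 ^ i) - weight h n ∣ ≤ 1
weight-+3^ h       zero    n _ rewrite +-comm n 1 = weight-suc h n
weight-+3^ (suc h) (suc i) n (s≤s i<h) rewrite *-comm 3 (3 ^ i) =
  weight-+*3 (λ a b → ∣ a - b ∣ ≤ 1) id h (3 ^ i) (λ q → weight-+3^ h i q i<h) n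

totalWeight : ℕ → ℕ
totalWeight h = ∑[ n < 3 ^ h ] weight h n

totalWeight-suc : ∀ h → totalWeight (suc h) ≡ 3 * totalWeight h + 2 * 3 ^ h
totalWeight-suc h = begin
  ∑[ n < 3 * N ] weight (suc h) n
    ≡⟨ cong (λ M → ∑[ n < M ] weight (suc h) n) (*-comm 3 N) ⟩
  ∑[ n < N * 3 ] weight (suc h) n
    ≡⟨ ∑<-*3 N (weight (suc h)) ⟩
  ∑[ q < N ] (weight (suc h) (q * 3) + weight (suc h) (1 + q * 3) + weight (suc h) (2 + q * 3))
    ≡⟨ ∑-cong (upTo N) (λ {q} _ → digits q) ⟩
  ∑[ q < N ] (weight h q + weight h q + weight h (suc q) + 2)
    ≡⟨ ∑-distrib-+ (upTo N) _ (λ _ → 2) ⟩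
  ∑[ q < N ] (weight h q + weight h q + weight h (suc q)) + ∑[ q < N ] 2
    ≡⟨ cong₂ _+_ (trans (∑-distrib-+ (upTo N) _ _) (cong₂ _+_ (∑-distrib-+ (upTo N) _ _) rotate)) (∑<-const N 2) ⟩
  totalWeight h + totalWeight h + totalWeight h + N * 2
    ≡⟨ collect (totalWeight h) N ⟩
  3 * totalWeight h + 2 * N ∎
  where
  open ≡-Reasoning
  N = 3 ^ h
  digits : ∀ q → weight (suc h) (q * 3) + weight (suc h) (1 + q * 3) + weight (suc h) (2 + q * 3)
                 ≡ weight h q + weight h q + weight h (suc q) + 2
  digits q rewrite weight-rem0 h q | weight-rem1 h q | weight-rem2 h q =
    shuffle (weight h q) (weight h (suc q))
    where
    shuffle : ∀ x y → x + suc x + suc y ≡ x + x + y + 2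
    shuffle = solve-∀
  rotate : ∑[ q < N ] weight h (suc q) ≡ totalWeight h
  rotate = ∑<-rotate N (weight h) (weight-periodic h 0)
  collect : ∀ t n → t + t + t + n * 2 ≡ 3 * t + 2 * n
  collect = solve-∀

totalWeight-closed : ∀ g → totalWeight (suc g) ≡ suc g * 2 * 3 ^ g
totalWeight-closed zero    = refl
totalWeight-closed (suc g) = begin
  totalWeight (2 + g)                          ≡⟨ totalWeight-suc (suc g) ⟩
  3 * totalWeight (suc g) + 2 * 3 ^ suc g      ≡⟨ cong (λ t → 3 * t + 2 * 3 ^ suc g) (totalWeight-closed g) ⟩
  3 * (suc g * 2 * 3 ^ g) + 2 * (3 * 3 ^ g)    ≡⟨ expand g (3 ^ g) ⟩
  (2 + g) * 2 * (3 * 3 ^ g)                    ∎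
  where
  open ≡-Reasoning
  expand : ∀ g p → 3 * (suc g * 2 * p) + 2 * (3 * p) ≡ (2 + g) * 2 * (3 * p)
  expand = solve-∀

[a+3^i]*3≡a*3+3^[1+i] : ∀ a i → (a + 3 ^ i) * 3 ≡ a * 3 + 3 ^ suc i
[a+3^i]*3≡a*3+3^[1+i] a i = trans (*-distribʳ-+ 3 a (3 ^ i)) (cong (_+_ (a * 3)) (*-comm (3 ^ i) 3))

Adjacent : ℕ → ℕ → ℕ → Set
Adjacent h a b = ∃ λ i → i < h × (a ≡ b + 3 ^ i [mod3^ h ] ⊎ a + 3 ^ i ≡ b [mod3^ h ])

module _ (h : ℕ) where
  private instance
    3^h≢0 : NonZero (3 ^ h)
    3^h≢0 = m^n≢0 3 h

  weight-+*3^h : ∀ k n → weight h (n + k * 3 ^ h) ≡ weight h n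
  weight-+*3^h zero    n = cong (weight h) (+-identityʳ n)
  weight-+*3^h (suc k) n = begin
    weight h (n + (3 ^ h + k * 3 ^ h))  ≡⟨ cong (weight h) (+-assoc n (3 ^ h) _) ⟨
    weight h (n + 3 ^ h + k * 3 ^ h)    ≡⟨ weight-+*3^h k (n + 3 ^ h) ⟩
    weight h (n + 3 ^ h)                ≡⟨ weight-periodic h n ⟩
    weight h n                          ∎
    where open ≡-Reasoning

  weight-% : ∀ n → weight h (n % 3 ^ h) ≡ weight h n
  weight-% n = trans (sym (weight-+*3^h (n / 3 ^ h) (n % 3 ^ h))) (cong (weight h) (sym (m≡m%n+[m/n]*n n (3 ^ h))))

  weight-cong : ∀ {a b} → a ≡ b [mod3^ h ] → weight h a ≡ weight h b
  weight-cong {a} {b} a≡b = trans (sym (weight-% a)) (trans (cong (weight h) a≡b) (weight-% b))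

  weight-adjacent : ∀ {a b} → Adjacent h a b → weight h a ≤ suc (weight h b)
  weight-adjacent {a} {b} (i , i<h , inj₁ a≡b+3^i) =
    subst (_≤ suc (weight h b)) (weight-cong (sym a≡b+3^i)) (∣m-n∣≤1⇒m≤1+n (weight-+3^ h i b i<h))
  weight-adjacent {a} {b} (i , i<h , inj₂ a+3^i≡b) =
    subst (λ t → weight h a ≤ suc t) (weight-cong a+3^i≡b)
      (∣m-n∣≤1⇒m≤1+n (subst (_≤ 1) (∣-∣-comm (weight h (a + 3 ^ i)) (weight h a)) (weight-+3^ h i a i<h)))

  Adjacent-translate : ∀ c {a b} → Adjacent h a b → Adjacent h (c + a) (c + b)
  Adjacent-translate c {a} {b} (i , i<h , inj₁ a≡b+3^i) =
    i , i<h , inj₁ (trans (≡[mod]-+ˡ c a≡b+3^i) (cong (_% 3 ^ h) (sym (+-assoc c b (3 ^ i)))))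
  Adjacent-translate c {a} {b} (i , i<h , inj₂ a+3^i≡b) =
    i , i<h , inj₂ (trans (cong (_% 3 ^ h) (+-assoc c a (3 ^ i))) (≡[mod]-+ˡ c a+3^i≡b))

  Adjacent-reflect : ∀ {a b} → a ≤ 3 ^ h → b ≤ 3 ^ h → Adjacent h a b → Adjacent h (3 ^ h ∸ a) (3 ^ h ∸ b)
  Adjacent-reflect {a} {b} a≤N b≤N (i , i<h , inj₁ a≡b+3^i) = i , i<h , inj₂ (≡[mod]-cancel-+ˡ a a≤N (begin
    (a + ((N ∸ a) + 3 ^ i)) % N  ≡⟨ cong (_% N) (m+[[n∸m]+o]≡n+o (3 ^ i) a≤N) ⟩
    (N + 3 ^ i) % N              ≡⟨ cong (_% N) (m+o+[n∸m]≡n+o (3 ^ i) b≤N) ⟨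
    (b + 3 ^ i + (N ∸ b)) % N    ≡⟨ ≡[mod]-+ʳ (N ∸ b) {a} {b + 3 ^ i} a≡b+3^i ⟨
    (a + (N ∸ b)) % N            ∎))
    where
    N = 3 ^ h
    open ≡-Reasoning
  Adjacent-reflect {a} {b} a≤N b≤N (i , i<h , inj₂ a+3^i≡b) = i , i<h , inj₁ (≡[mod]-cancel-+ˡ b b≤N (begin
    (b + (N ∸ a)) % N            ≡⟨ ≡[mod]-+ʳ (N ∸ a) {a + 3 ^ i} {b} a+3^i≡b ⟨
    (a + 3 ^ i + (N ∸ a)) % N    ≡⟨ cong (_% N) (m+o+[n∸m]≡n+o (3 ^ i) a≤N) ⟩
    (N + 3 ^ i) % N              ≡⟨ cong (_% N) (m+[[n∸m]+o]≡n+o (3 ^ i) b≤N) ⟨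
    (b + ((N ∸ b) + 3 ^ i)) % N  ∎))
    where
    N = 3 ^ h
    open ≡-Reasoning

  Adjacent-resp : ∀ {a a′ b b′} → a ≡ a′ [mod3^ h ] → b ≡ b′ [mod3^ h ] → Adjacent h a b → Adjacent h a′ b′
  Adjacent-resp {b = b} {b′} a≡a′ b≡b′ (i , i<h , inj₁ a≡b+3^i) =
    i , i<h , inj₁ (trans (sym a≡a′) (trans a≡b+3^i (≡[mod]-+ʳ (3 ^ i) {b} {b′} b≡b′)))
  Adjacent-resp {a} {a′} a≡a′ b≡b′ (i , i<h , inj₂ a+3^i≡b) =
    i , i<h , inj₂ (trans (sym (≡[mod]-+ʳ (3 ^ i) {a} {a′} a≡a′)) (trans a+3^i≡b b≡b′))

  MC⇒Adjacent : ∀ {x y} → MC 3 h x y → Adjacent h (toℕ x) (toℕ y)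
  MC⇒Adjacent {x} {y} (_ , i , i<h , inj₁ N∣x-y-3^i) =
    i , i<h , inj₁ (∣ℤ⇒≡[mod] (toℕ x) (toℕ y + 3 ^ i)
                      (subst (+ 3 ^ h ∣ℤ_) ([+a-+b]-+c≡+a-+[b+c] (toℕ x) (toℕ y) (3 ^ i)) N∣x-y-3^i))
  MC⇒Adjacent {x} {y} (_ , i , i<h , inj₂ N∣x-y+3^i) =
    i , i<h , inj₂ (∣ℤ⇒≡[mod] (toℕ x + 3 ^ i) (toℕ y)
                      (subst (+ 3 ^ h ∣ℤ_) ([+a-+b]++c≡+[a+c]-+b (toℕ x) (toℕ y) (3 ^ i)) N∣x-y+3^i))

  Adjacent⇒MC : ∀ {x y} → x ≢ y → Adjacent h (toℕ x) (toℕ y) → MC 3 h x y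
  Adjacent⇒MC {x} {y} x≢y (i , i<h , inj₁ x≡y+3^i) =
    x≢y , i , i<h , inj₁ (subst (+ 3 ^ h ∣ℤ_) (sym ([+a-+b]-+c≡+a-+[b+c] (toℕ x) (toℕ y) (3 ^ i)))
                                (≡[mod]⇒∣ℤ _ _ x≡y+3^i))
  Adjacent⇒MC {x} {y} x≢y (i , i<h , inj₂ x+3^i≡y) =
    x≢y , i , i<h , inj₂ (subst (+ 3 ^ h ∣ℤ_) (sym ([+a-+b]++c≡+[a+c]-+b (toℕ x) (toℕ y) (3 ^ i)))
                                (≡[mod]⇒∣ℤ _ _ x+3^i≡y))

  offset : Fin (3 ^ h) → Fin (3 ^ h) → ℕ
  offset x y = (toℕ y + (3 ^ h ∸ toℕ x)) % 3 ^ h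

  offset-self : ∀ x → offset x x ≡ 0
  offset-self x = trans (cong (_% 3 ^ h) (m+[n∸m]≡n (<⇒≤ (toℕ<n x)))) (n%n≡0 (3 ^ h))

  weight-offset-adjacent : ∀ {v u} y → MC 3 h v u → weight h (offset v y) ≤ suc (weight h (offset u y))
  weight-offset-adjacent {v} {u} y v~u = weight-adjacent
    (Adjacent-resp (sym (m%n%n≡m%n _ (3 ^ h))) (sym (m%n%n≡m%n _ (3 ^ h)))
      (Adjacent-translate (toℕ y) (Adjacent-reflect (<⇒≤ (toℕ<n v)) (<⇒≤ (toℕ<n u)) (MC⇒Adjacent v~u))))

  weight-offset≤walk : ∀ y v vs → Linked (MC 3 h) (v ∷ vs ++ y ∷ []) → weight h (offset v y) ≤ suc (length vs)
  weight-offset≤walk y v []       (v~y ∷ _) =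
    subst (λ t → weight h (offset v y) ≤ suc t) weight-offset-self (weight-offset-adjacent y v~y)
    where
    weight-offset-self : weight h (offset y y) ≡ 0
    weight-offset-self = trans (cong (weight h) (offset-self y)) (weight-0 h)
  weight-offset≤walk y v (u ∷ vs) (v~u ∷ walk) =
    ≤-trans (weight-offset-adjacent y v~u) (s≤s (weight-offset≤walk y u vs walk))

  ∑-offset : ∀ x (F : ℕ → ℕ) → ∑[ y ∈ allFin (3 ^ h) ] F (offset x y) ≡ ∑[ k < 3 ^ h ] F k
  ∑-offset x F = begin
    ∑[ y ∈ allFin N ] F ((toℕ y + (N ∸ toℕ x)) % N)
      ≡⟨ ∑-allFin N (λ k → F ((k + (N ∸ toℕ x)) % N)) ⟩
    ∑[ k < N ] F ((k + (N ∸ toℕ x)) % N)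
      ≡⟨ ∑<-shift-periodic N (F ∘ (_% N)) (λ m → cong F ([m+n]%n≡m%n m N)) (N ∸ toℕ x) ⟩
    ∑[ k < N ] F (k % N)
      ≡⟨ ∑<-cong N (cong F ∘ m<n⇒m%n≡m) ⟩
    ∑[ k < N ] F k ∎
    where
    N = 3 ^ h
    open ≡-Reasoning

  module _ (R : Routing (MC 3 h)) where

    weight-offset+𝟙≤pathLength+1 : ∀ x y → weight h (offset x y) + 𝟙 (x ≟ y) ≤ pathLength R x y + 1
    weight-offset+𝟙≤pathLength+1 x y with x ≟ y
    ... | yes refl rewrite offset-self x | weight-0 h = ≤-refl
    ... | no x≢y = subst₂ _≤_ (sym (+-identityʳ _)) (+-comm 1 _)
                     (weight-offset≤walk y x (proj₁ (R x y x≢y)) (proj₁ (proj₂ (R x y x≢y))))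

    totalWeight≤pred[3^h]+maxLoad : totalWeight h ≤ pred (3 ^ h) + maxLoad R
    totalWeight≤pred[3^h]+maxLoad = ≤-pred (subst₂ _≤_ (+-comm (totalWeight h) 1) N+maxLoad≡ T+1≤maxLoad+N)
      where
      N = 3 ^ h
      N+maxLoad≡ : maxLoad R + N ≡ suc (pred N + maxLoad R)
      N+maxLoad≡ = trans (+-comm (maxLoad R) N) (cong (_+ maxLoad R) (sym (suc-pred N)))
      T+1≤maxLoad+N : totalWeight h + 1 ≤ maxLoad R + N
      T+1≤maxLoad+N = *-cancelˡ-≤ N (begin
        N * (totalWeight h + 1)
          ≡⟨ ∑-allFin-const N (totalWeight h + 1) ⟨
        ∑[ x ∈ allFin N ] (totalWeight h + 1)
          ≡⟨ ∑-cong (allFin N) (λ {x} _ → cong₂ _+_ (∑-offset x (weight h)) (∑-𝟙-≟ʳ x)) ⟨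
        ∑[ x ∈ allFin N ] (∑[ y ∈ allFin N ] weight h (offset x y) + ∑[ y ∈ allFin N ] 𝟙 (x ≟ y))
          ≡⟨ ∑-cong (allFin N) (λ {x} _ → ∑-distrib-+ (allFin N) _ _) ⟨
        ∑[ x ∈ allFin N ] ∑[ y ∈ allFin N ] (weight h (offset x y) + 𝟙 (x ≟ y))
          ≤⟨ ∑-mono-≤ (allFin N) (λ x → ∑-mono-≤ (allFin N) (weight-offset+𝟙≤pathLength+1 x)) ⟩
        ∑[ x ∈ allFin N ] ∑[ y ∈ allFin N ] (pathLength R x y + 1)
          ≡⟨ ∑-cong (allFin N) (λ {x} _ → trans (∑-distrib-+ (allFin N) _ _) (cong (_+_ _) (∑-allFin-const N 1))) ⟩
        ∑[ x ∈ allFin N ] (∑[ y ∈ allFin N ] pathLength R x y + N * 1)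
          ≡⟨ ∑-distrib-+ (allFin N) _ _ ⟩
        ∑[ x ∈ allFin N ] ∑[ y ∈ allFin N ] pathLength R x y + ∑[ x ∈ allFin N ] (N * 1)
          ≡⟨ cong₂ _+_ (sym (∑-load≡∑-pathLength R)) (trans (∑-allFin-const N (N * 1)) (cong (N *_) (*-identityʳ N))) ⟩
        ∑[ z ∈ allFin N ] load R z + N * N
          ≤⟨ +-monoˡ-≤ (N * N) (∑-load≤n*maxLoad R) ⟩
        N * maxLoad R + N * N
          ≡⟨ *-distribˡ-+ N (maxLoad R) N ⟨
        N * (maxLoad R + N) ∎)
        where open ≤-Reasoning

module _ (h : ℕ) where
  private instance
    3^h≢0 : NonZero (3 ^ h)
    3^h≢0 = m^n≢0 3 h
    3^[1+h]≢0 : NonZero (3 ^ suc h)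
    3^[1+h]≢0 = m^n≢0 3 (suc h)
    3^h*3≢0 : NonZero (3 ^ h * 3)
    3^h*3≢0 = m*n≢0 (3 ^ h) 3

  %-*3 : ∀ a → (a * 3) % 3 ^ suc h ≡ (a % 3 ^ h) * 3
  %-*3 a = trans (%-congʳ (*-comm 3 (3 ^ h))) (sym (m%n*o≡m*o%[n*o] a (3 ^ h) 3))

  ≡[mod]-*3 : ∀ {a b} → a ≡ b [mod3^ h ] → a * 3 ≡ b * 3 [mod3^ suc h ]
  ≡[mod]-*3 {a} {b} a≡b = trans (%-*3 a) (trans (cong (_* 3) a≡b) (sym (%-*3 b)))

  ≡[mod]-/3 : ∀ {a b} → a * 3 ≡ b * 3 [mod3^ suc h ] → a ≡ b [mod3^ h ]
  ≡[mod]-/3 {a} {b} 3a≡3b = *-cancelʳ-≡ _ _ 3 (trans (sym (%-*3 a)) (trans 3a≡3b (%-*3 b)))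

  ≡[mod]⇒%3 : ∀ {a b} → a ≡ b [mod3^ suc h ] → a % 3 ≡ b % 3
  ≡[mod]⇒%3 {a} {b} a≡b = trans (sym (reduce a)) (trans (cong (_% 3) a≡b) (reduce b))
    where
    reduce : ∀ n → n % 3 ^ suc h % 3 ≡ n % 3
    reduce n = m∣n⇒o%n%m≡o%m 3 (3 ^ suc h) n (divides (3 ^ h) (*-comm 3 (3 ^ h)))

  Adjacent-*3 : ∀ {a b} → Adjacent h a b → Adjacent (suc h) (a * 3) (b * 3)
  Adjacent-*3 {a} {b} (i , i<h , inj₁ a≡b+3^i) =
    suc i , s≤s i<h , inj₁ (trans (≡[mod]-*3 a≡b+3^i) (cong (_% 3 ^ suc h) ([a+3^i]*3≡a*3+3^[1+i] b i)))
  Adjacent-*3 {a} {b} (i , i<h , inj₂ a+3^i≡b) =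
    suc i , s≤s i<h , inj₂ (trans (cong (_% 3 ^ suc h) (sym ([a+3^i]*3≡a*3+3^[1+i] a i))) (≡[mod]-*3 a+3^i≡b))

geodesic : ℕ → ℕ → List ℕ
geodesic zero    n = []
geodesic (suc h) n with ternary n
... | rem0 q = map (_* 3) (geodesic h q)
... | rem1 q = map (_* 3) (geodesic h q) ++ 1 + q * 3 ∷ []
... | rem2 q = map (_* 3) (geodesic h (suc q)) ++ 2 + q * 3 ∷ []

length-geodesic : ∀ h n → length (geodesic h n) ≡ weight h n
length-geodesic zero    n = refl
length-geodesic (suc h) n with ternary n
... | rem0 q = trans (length-map (_* 3) (geodesic h q)) (length-geodesic h q)
... | rem1 q = trans (length-∷ʳ (map (_* 3) (geodesic h q)) (1 + q * 3))
                 (cong suc (trans (length-map (_* 3) (geodesic h q)) (length-geodesic h q)))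
... | rem2 q = trans (length-∷ʳ (map (_* 3) (geodesic h (suc q))) (2 + q * 3))
                 (cong suc (trans (length-map (_* 3) (geodesic h (suc q))) (length-geodesic h (suc q))))

last-geodesic : ∀ h n → last 0 (geodesic h n) ≡ n [mod3^ h ]

last-geodesic-*3 : ∀ h q → last 0 (map (_* 3) (geodesic h q)) ≡ q * 3 [mod3^ suc h ]
last-geodesic-*3 h q =
  trans (≡⇒≡[mod3^] (suc h) (last-map (_* 3) 0 (geodesic h q))) (≡[mod]-*3 h (last-geodesic h q))

last-geodesic zero    n = sym (n%1≡0 n)
last-geodesic (suc h) n with ternary n
... | rem0 q = last-geodesic-*3 h q
... | rem1 q = ≡⇒≡[mod3^] (suc h) (last-∷ʳ 0 (map (_* 3) (geodesic h q)) (1 + q * 3))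
... | rem2 q = ≡⇒≡[mod3^] (suc h) (last-∷ʳ 0 (map (_* 3) (geodesic h (suc q))) (2 + q * 3))

geodesic-adjacent : ∀ h n → Linked (Adjacent h) (0 ∷ geodesic h n)

geodesic-*3-adjacent : ∀ h q → Linked (Adjacent (suc h)) (0 ∷ map (_* 3) (geodesic h q))
geodesic-*3-adjacent h q = Linked.map⁺ (Linked.map (Adjacent-*3 h) (geodesic-adjacent h q))

geodesic-adjacent zero    n = [-]
geodesic-adjacent (suc h) n with ternary n
... | rem0 q = geodesic-*3-adjacent h q
... | rem1 q = Linked-∷ʳ (map (_* 3) (geodesic h q)) (geodesic-*3-adjacent h q)
    (0 , s≤s z≤n , inj₂ (trans (≡[mod]-+ʳ 1 {last 0 (map (_* 3) (geodesic h q))} (last-geodesic-*3 h q))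
                              (≡⇒≡[mod3^] (suc h) (+-comm (q * 3) 1))))
  where instance _ = m^n≢0 3 (suc h)
... | rem2 q = Linked-∷ʳ (map (_* 3) (geodesic h (suc q))) (geodesic-*3-adjacent h (suc q))
    (0 , s≤s z≤n , inj₁ (trans (last-geodesic-*3 h (suc q)) (≡⇒≡[mod3^] (suc h) (+-comm 1 (2 + q * 3)))))
  where instance _ = m^n≢0 3 (suc h)

geodesic-distinct : ∀ h n → AllPairs (λ a b → ¬ a ≡ b [mod3^ h ]) (0 ∷ geodesic h n)

geodesic-*3-distinct : ∀ h q → AllPairs (λ a b → ¬ a ≡ b [mod3^ suc h ]) (0 ∷ map (_* 3) (geodesic h q))
geodesic-*3-distinct h q = AllPairs.map⁺ (AllPairs.map (λ a≢b → a≢b ∘ ≡[mod]-/3 h) (geodesic-distinct h q))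

*3≢1+*3 : ∀ h a q → ¬ a * 3 ≡ 1 + q * 3 [mod3^ suc h ]
*3≢1+*3 h a q eq = 0≢1+n (trans (sym (m*n%n≡0 a 3)) (trans (≡[mod]⇒%3 h eq) ([m+kn]%n≡m%n 1 q 3)))

*3≢2+*3 : ∀ h a q → ¬ a * 3 ≡ 2 + q * 3 [mod3^ suc h ]
*3≢2+*3 h a q eq = 0≢1+n (trans (sym (m*n%n≡0 a 3)) (trans (≡[mod]⇒%3 h eq) ([m+kn]%n≡m%n 2 q 3)))

geodesic-distinct zero    n = [] ∷ []
geodesic-distinct (suc h) n with ternary n
... | rem0 q = geodesic-*3-distinct h q
... | rem1 q = AllPairs.++⁺ (geodesic-*3-distinct h q) ([] ∷ [])
                 (All.map⁺ (All.universal (λ a → *3≢1+*3 h a q ∷ []) (0 ∷ geodesic h q)))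
... | rem2 q = AllPairs.++⁺ (geodesic-*3-distinct h (suc q)) ([] ∷ [])
                 (All.map⁺ (All.universal (λ a → *3≢2+*3 h a q ∷ []) (0 ∷ geodesic h (suc q))))

geodesic-0 : ∀ h → geodesic h 0 ≡ []
geodesic-0 zero    = refl
geodesic-0 (suc h) = cong (map (_* 3)) (geodesic-0 h)

module _ (h : ℕ) where
  private
    N = 3 ^ h
    instance
      3^h≢0 : NonZero N
      3^h≢0 = m^n≢0 3 h

  shift : Fin N → ℕ → Fin N
  shift x o = fromℕ< (m%n<n (toℕ x + o) N)

  toℕ-shift : ∀ x o → toℕ (shift x o) ≡ toℕ x + o [mod3^ h ]
  toℕ-shift x o = trans (cong (_% N) (toℕ-fromℕ< _)) (m%n%n≡m%n (toℕ x + o) N)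

  shift-offset : ∀ x y {o} → o ≡ offset h x y [mod3^ h ] → shift x o ≡ y
  shift-offset x y {o} o≡offset = toℕ-injective (begin
    toℕ (shift x o)                       ≡⟨ toℕ-fromℕ< _ ⟩
    (toℕ x + o) % N                       ≡⟨ ≡[mod]-+ˡ (toℕ x) (trans o≡offset (m%n%n≡m%n _ N)) ⟩
    (toℕ x + (toℕ y + (N ∸ toℕ x))) % N   ≡⟨ cong (_% N) (+-assoc (toℕ x) (toℕ y) _) ⟨
    (toℕ x + toℕ y + (N ∸ toℕ x)) % N     ≡⟨ cong (_% N) (m+o+[n∸m]≡n+o (toℕ y) x≤N) ⟩
    (N + toℕ y) % N                       ≡⟨ cong (_% N) (+-comm N (toℕ y)) ⟩
    (toℕ y + N) % N                       ≡⟨ [m+n]%n≡m%n (toℕ y) N ⟩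
    toℕ y % N                             ≡⟨ m<n⇒m%n≡m (toℕ<n y) ⟩
    toℕ y                                 ∎)
    where
    open ≡-Reasoning
    x≤N = <⇒≤ (toℕ<n x)

  shift-0 : ∀ x → shift x 0 ≡ x
  shift-0 x = shift-offset x x (≡⇒≡[mod3^] h (sym (offset-self h x)))

  shift-injective : ∀ x {a b} → shift x a ≡ shift x b → a ≡ b [mod3^ h ]
  shift-injective x {a} {b} eq =
    ≡[mod]-cancel-+ˡ (toℕ x) (<⇒≤ (toℕ<n x))
      (trans (sym (toℕ-shift x a)) (trans (cong (λ t → toℕ t % N) eq) (toℕ-shift x b)))

  shift-adjacent : ∀ x {a b} → Adjacent h a b → ¬ a ≡ b [mod3^ h ] → MC 3 h (shift x a) (shift x b)
  shift-adjacent x {a} {b} adj a≢b = Adjacent⇒MC h (a≢b ∘ shift-injective x)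
    (Adjacent-resp h (sym (toℕ-shift x a)) (sym (toℕ-shift x b)) (Adjacent-translate h (toℕ x) adj))

  geodesicPath : ∀ x y → x ≢ y → IsPath (MC 3 h) x y (map (shift x) (init (geodesic h (offset h x y))))
  geodesicPath x y x≢y = along (geodesic h (offset h x y))
    (geodesic-adjacent h _) (geodesic-distinct h _) (last-geodesic h _)
    where
    along : ∀ L → Linked (Adjacent h) (0 ∷ L) → AllPairs (λ a b → ¬ a ≡ b [mod3^ h ]) (0 ∷ L) →
            last 0 L ≡ offset h x y [mod3^ h ] → IsPath (MC 3 h) x y (map (shift x) (init L))
    along []      _        _        last≡ = ⊥-elim (x≢y (trans (sym (shift-0 x)) (shift-offset x y last≡)))
    along (a ∷ l) adjacent distinct last≡ =
      subst (Linked (MC 3 h)) endpoints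
        (Linked.map⁺ (Linked.zipWith (uncurry (shift-adjacent x)) (adjacent , Linked.AllPairs⇒Linked distinct))) ,
      subst Unique endpoints (AllPairs.map⁺ (AllPairs.map (λ a≢b → a≢b ∘ shift-injective x) distinct))
      where
      endpoints : map (shift x) (0 ∷ a ∷ l) ≡ x ∷ map (shift x) (init (a ∷ l)) ++ y ∷ []
      endpoints = cong₂ _∷_ (shift-0 x) (begin
        map (shift x) (a ∷ l)                                    ≡⟨ cong (map (shift x)) (∷≡init++last a l) ⟩
        map (shift x) (init (a ∷ l) ++ last a l ∷ [])            ≡⟨ map-++ (shift x) (init (a ∷ l)) _ ⟩
        map (shift x) (init (a ∷ l)) ++ shift x (last a l) ∷ []  ≡⟨ cong (λ v → _ ++ v ∷ []) (shift-offset x y last≡) ⟩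
        map (shift x) (init (a ∷ l)) ++ y ∷ []                   ∎)
        where open ≡-Reasoning

  geodesicRouting : Routing (MC 3 h)
  geodesicRouting x y x≢y = _ , geodesicPath x y x≢y

  open DecMembership (_≟_ {N}) using (_∈?_)

  ∑-shift : ∀ o (F : Fin N → ℕ) → ∑[ x ∈ allFin N ] F (shift x o) ≡ ∑[ x ∈ allFin N ] F x
  ∑-shift o F = begin
    ∑[ x ∈ allFin N ] G (toℕ x + o)  ≡⟨ ∑-allFin N (λ k → G (k + o)) ⟩
    ∑[ k < N ] G (k + o)             ≡⟨ ∑<-shift-periodic N G G-periodic o ⟩
    ∑[ k < N ] G k                   ≡⟨ ∑-allFin N G ⟨
    ∑[ x ∈ allFin N ] G (toℕ x)      ≡⟨ ∑-cong (allFin N) (λ {x} _ → cong F (fromℕ<-% x)) ⟩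
    ∑[ x ∈ allFin N ] F x            ∎
    where
    open ≡-Reasoning
    G : ℕ → ℕ
    G m = F (fromℕ< (m%n<n m N))
    G-periodic : ∀ m → G (m + N) ≡ G m
    G-periodic m = cong F (fromℕ<-cong _ _ ([m+n]%n≡m%n m N) _ _)
    fromℕ<-% : ∀ x → fromℕ< (m%n<n (toℕ x) N) ≡ x
    fromℕ<-% x = toℕ-injective (trans (toℕ-fromℕ< _) (m<n⇒m%n≡m (toℕ<n x)))

  weight-pos : ∀ {k} → 0 < k → k < N → 0 < weight h k
  weight-pos {k} 0<k k<N with geodesic h k | length-geodesic h k | last-geodesic h k
  ... | []    | len≡ | last≡ = ⊥-elim (<⇒≢ 0<k (begin
    0      ≡⟨ m<n⇒m%n≡m (<-trans 0<k k<N) ⟨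
    0 % N  ≡⟨ last≡ ⟩
    k % N  ≡⟨ m<n⇒m%n≡m k<N ⟩
    k      ∎))
    where open ≡-Reasoning
  ... | _ ∷ _ | len≡ | _     = subst (0 <_) len≡ (s≤s z≤n)

  through : Fin N → Fin N → ℕ → ℕ
  through z x k = 𝟙 (z ∈? map (shift x) (init (geodesic h k)))

  passes≡through : ∀ z x y → passes geodesicRouting z x y ≡ through z x (offset h x y)
  passes≡through z x y with x ≟ y
  ... | yes refl rewrite offset-self h x | geodesic-0 h = refl
  ... | no  _    = refl

  ∑-through : ∀ z k → ∑[ x ∈ allFin N ] through z x k ≡ pred (weight h k)
  ∑-through z k = begin
    ∑[ x ∈ allFin N ] 𝟙 (z ∈? map (shift x) I)
      ≡⟨ ∑-cong (allFin N) (λ {x} _ → 𝟙-∈-unique z (shifted-unique x)) ⟩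
    ∑[ x ∈ allFin N ] ∑[ v ∈ map (shift x) I ] 𝟙 (z ≟ v)
      ≡⟨ ∑-cong (allFin N) (λ {x} _ → cong sum (sym (map-∘ I))) ⟩
    ∑[ x ∈ allFin N ] ∑[ o ∈ I ] 𝟙 (z ≟ shift x o)
      ≡⟨ ∑-comm (allFin N) I _ ⟩
    ∑[ o ∈ I ] ∑[ x ∈ allFin N ] 𝟙 (z ≟ shift x o)
      ≡⟨ ∑-cong I (λ {o} _ → trans (∑-shift o (λ v → 𝟙 (z ≟ v))) (∑-𝟙-≟ʳ z)) ⟩
    ∑[ o ∈ I ] 1
      ≡⟨ trans (∑-const I 1) (*-identityʳ (length I)) ⟩
    length I
      ≡⟨ length-init (geodesic h k) ⟩
    pred (length (geodesic h k))
      ≡⟨ cong pred (length-geodesic h k) ⟩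
    pred (weight h k) ∎
    where
    open ≡-Reasoning
    I = init (geodesic h k)
    shifted-unique : ∀ x → Unique (map (shift x) I)
    shifted-unique x = AllPairs.map⁺ (AllPairs.map (λ a≢b → a≢b ∘ shift-injective x)
      (AllPairs-init (geodesic h k) (AllPairs.tail (geodesic-distinct h k))))

  ∑-pred-weight : ∑[ k < N ] pred (weight h k) + pred N ≡ totalWeight h
  ∑-pred-weight = begin
    ∑[ k < N ] pred (weight h k) + M
      ≡⟨ cong (λ n → ∑[ k < n ] pred (weight h k) + M) N≡1+M ⟩
    ∑[ k < suc M ] pred (weight h k) + M
      ≡⟨ cong (_+ M) (∑<-suc M (pred ∘ weight h)) ⟩
    pred (weight h 0) + ∑[ k < M ] pred (weight h (suc k)) + M
      ≡⟨ cong (λ w → pred w + ∑[ k < M ] pred (weight h (suc k)) + M) (weight-0 h) ⟩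
    ∑[ k < M ] pred (weight h (suc k)) + M
      ≡⟨ cong (_+_ _) (trans (sym (*-identityʳ M)) (sym (∑<-const M 1))) ⟩
    ∑[ k < M ] pred (weight h (suc k)) + ∑[ k < M ] 1
      ≡⟨ ∑-distrib-+ (upTo M) _ _ ⟨
    ∑[ k < M ] (pred (weight h (suc k)) + 1)
      ≡⟨ ∑<-cong M (λ k<M → trans (+-comm _ 1) (suc-pred-weight k<M)) ⟩
    ∑[ k < M ] weight h (suc k)
      ≡⟨ cong (λ w → w + ∑[ k < M ] weight h (suc k)) (weight-0 h) ⟨
    weight h 0 + ∑[ k < M ] weight h (suc k)
      ≡⟨ ∑<-suc M (weight h) ⟨
    ∑[ k < suc M ] weight h k
      ≡⟨ cong (λ n → ∑[ k < n ] weight h k) N≡1+M ⟨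
    totalWeight h ∎
    where
    open ≡-Reasoning
    M = pred N
    N≡1+M : N ≡ suc M
    N≡1+M = sym (suc-pred N)
    suc-pred-weight : ∀ {k} → k < M → suc (pred (weight h (suc k))) ≡ weight h (suc k)
    suc-pred-weight k<M = suc-pred _ {{>-nonZero (weight-pos (s≤s z≤n) (subst (_ <_) (sym N≡1+M) (s≤s k<M)))}}

  load-geodesicRouting : ∀ z → load geodesicRouting z + pred N ≡ totalWeight h
  load-geodesicRouting z = trans (cong (_+ pred N) load≡) ∑-pred-weight
    where
    open ≡-Reasoning
    load≡ : load geodesicRouting z ≡ ∑[ k < N ] pred (weight h k)
    load≡ = begin
      load geodesicRouting z
        ≡⟨ load≡∑passes geodesicRouting z ⟩
      ∑[ x ∈ allFin N ] ∑[ y ∈ allFin N ] passes geodesicRouting z x y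
        ≡⟨ ∑-cong (allFin N) (λ {x} _ → ∑-cong (allFin N) (λ {y} _ → passes≡through z x y)) ⟩
      ∑[ x ∈ allFin N ] ∑[ y ∈ allFin N ] through z x (offset h x y)
        ≡⟨ ∑-cong (allFin N) (λ {x} _ → ∑-offset h x (through z x)) ⟩
      ∑[ x ∈ allFin N ] ∑[ k < N ] through z x k
        ≡⟨ ∑-comm (allFin N) (upTo N) _ ⟩
      ∑[ k < N ] ∑[ x ∈ allFin N ] through z x k
        ≡⟨ ∑-cong (upTo N) (λ {k} _ → ∑-through z k) ⟩
      ∑[ k < N ] pred (weight h k) ∎

  pred[3^h]≤totalWeight : pred N ≤ totalWeight h
  pred[3^h]≤totalWeight = subst (pred N ≤_) ∑-pred-weight (m≤n+m (pred N) _)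

  isVertexForwardingIndex : IsVertexForwardingIndex (MC 3 h) (totalWeight h ∸ pred N)
  isVertexForwardingIndex = (geodesicRouting , ≤-antisym (maxLoad≤ geodesicRouting load≤) (lower geodesicRouting)) , lower
    where
    lower : ∀ R → totalWeight h ∸ pred N ≤ maxLoad R
    lower R = m≤n+o⇒m∸n≤o (totalWeight h) (pred N) (totalWeight≤pred[3^h]+maxLoad h R)
    load≤ : ∀ z → load geodesicRouting z ≤ totalWeight h ∸ pred N
    load≤ z = ≤-reflexive (trans (sym (m+n∸n≡m _ (pred N))) (cong (_∸ pred N) (load-geodesicRouting z)))

index-formula : ∀ g → + (totalWeight (suc g) ∸ pred (3 ^ suc g)) ≡ (+ 3 ^ g *ℤ (+ (2 * suc g) - + 3)) +ℤ + 1
index-formula g = begin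
  + K                                          ≡⟨ cancel (+ K) (+ p) ⟩
  (+ K +ℤ + 3 *ℤ + p) - + 3 *ℤ + p            ≡⟨ cong (λ t → t - + 3 *ℤ + p) ℤ-equation ⟩
  (+ suc g *ℤ + 2 *ℤ + p +ℤ + 1) - + 3 *ℤ + p ≡⟨ regroup (+ suc g) (+ p) ⟩
  + p *ℤ (+ 2 *ℤ + suc g - + 3) +ℤ + 1        ≡⟨ cong (λ t → + p *ℤ (t - + 3) +ℤ + 1) (ℤ.pos-* 2 (suc g)) ⟨
  + p *ℤ (+ (2 * suc g) - + 3) +ℤ + 1         ∎
  where
  open ≡-Reasoning
  p = 3 ^ g
  K = totalWeight (suc g) ∸ pred (3 * p)
  ℕ-equation : K + 3 * p ≡ suc g * 2 * p + 1
  ℕ-equation = begin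
    K + 3 * p                  ≡⟨ cong (_+_ K) (suc-pred (3 * p) {{m^n≢0 3 (suc g)}}) ⟨
    K + suc (pred (3 * p))     ≡⟨ +-suc K _ ⟩
    suc (K + pred (3 * p))     ≡⟨ cong suc (m∸n+n≡m (pred[3^h]≤totalWeight (suc g))) ⟩
    suc (totalWeight (suc g))  ≡⟨ cong suc (totalWeight-closed g) ⟩
    suc (suc g * 2 * p)        ≡⟨ +-comm 1 _ ⟩
    suc g * 2 * p + 1          ∎
  ℤ-equation : + K +ℤ + 3 *ℤ + p ≡ + suc g *ℤ + 2 *ℤ + p +ℤ + 1
  ℤ-equation = begin
    + K +ℤ + 3 *ℤ + p           ≡⟨ cong (_+ℤ_ (+ K)) (ℤ.pos-* 3 p) ⟨
    + K +ℤ + (3 * p)            ≡⟨ ℤ.pos-+ K (3 * p) ⟨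
    + (K + 3 * p)               ≡⟨ cong +_ ℕ-equation ⟩
    + (suc g * 2 * p + 1)       ≡⟨ ℤ.pos-+ (suc g * 2 * p) 1 ⟩
    + (suc g * 2 * p) +ℤ + 1    ≡⟨ cong (_+ℤ + 1) (trans (ℤ.pos-* (suc g * 2) p) (cong (_*ℤ + p) (ℤ.pos-* (suc g) 2))) ⟩
    + suc g *ℤ + 2 *ℤ + p +ℤ + 1 ∎
  cancel : ∀ k q → k ≡ (k +ℤ + 3 *ℤ q) - + 3 *ℤ q
  cancel = ℤSolver.solve-∀
  regroup : ∀ m q → (m *ℤ + 2 *ℤ q +ℤ + 1) - + 3 *ℤ q ≡ q *ℤ (+ 2 *ℤ m - + 3) +ℤ + 1
  regroup = ℤSolver.solve-∀

theorem3p30 : (h : ℕ) → 1 ≤ h →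
    Σ ℕ λ k → IsVertexForwardingIndex (MC 3 h) k ×
      (+ k ≡ ((+ (3 ^ (h ∸ 1))) *ℤ ((+ (2 Data.Nat.* h)) - (+ 3))) +ℤ (+ 1))
theorem3p30 (suc g) _ = totalWeight (suc g) ∸ pred (3 ^ suc g) , isVertexForwardingIndex (suc g) , index-formula g
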